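{- Let $G$ be an $r$-outerplanar triangulated disk with at least four vertices, and let $(A,B)$ be a nontrivial separation of $G$ of order two. Then $G[A\setminus B]$ and $G[B\setminus A]$ are connected components of $G-(A\cap B)$.
   Context: A triangulated disk is a plane graph whose outer face is bounded by a simple cycle and whose inner faces are all triangles; it is $r$-outerplanar if its layer decomposition (layer $L_1$ = vertices on the outer face, $L_i$ = vertices on the outer face after deleting $L_1,\dots,L_{i-1}$) has at most $r$ layers. A separation of $G$ is a pair $(A,B)$ of vertex sets with $A\cup B=V(G)$ and no edge between $A\setminus B$ and $B\setminus A$; its order is $|A\cap B|$; it is nontrivial if $A\setminus B\neq\emptyset\neq B\setminus A$. -}

module Defs where

open import Data.Nat using (ℕ; zero; suc; _+_; _*_; _≤_)
open import Data.Fin using (Fin)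
open import Data.Fin.Subset using (Subset; _∈_; _∉_; _∩_; _─_; ∣_∣)
open import Data.Product using (Σ; ∃; _×_; _,_)
open import Data.Sum using (_⊎_)
open import Data.Unit using (⊤)
open import Relation.Binary.PropositionalEquality using (_≡_; _≢_)
open import Relation.Nullary using (¬_)

iter : ∀ {A : Set} → (A → A) → ℕ → A → A
iter f zero x = x
iter f (suc k) x = f (iter f k x)

SameOrbit : ∀ {A : Set} → (A → A) → A → A → Set
SameOrbit f x y = ∃ λ k → iter f k x ≡ y

data Path {V : Set} (E : V → V → Set) (P : V → Set) : V → V → Set where
  here : ∀ {u} → P u → Path E P u u
  step : ∀ {u v w} → P u → E u v → Path E P v w → Path E P u w

-- A triangulated disk on vertex set Fin n, given as a combinatorial map
-- (rotation system): darts Fin d, fixed-point-free involution α (the two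
-- darts of an edge), rotation permutation σ (cyclic order of darts around
-- a vertex), faces = orbits of φ = σ ∘ α.  Planarity of the embedding is
-- expressed by Euler's formula V − E + F = 2 for the connected map
-- (E = d/2).
record TriangulatedDisk (n : ℕ) : Set where
  field
    d f      : ℕ
    α σ σ⁻¹  : Fin d → Fin d
    vert     : Fin d → Fin n
    face     : Fin d → Fin f
    outer    : Fin f
    α-invol  : ∀ x → α (α x) ≡ x
    α-nofix  : ∀ x → α x ≢ x
    σ-inv₁   : ∀ x → σ (σ⁻¹ x) ≡ x
    σ-inv₂   : ∀ x → σ⁻¹ (σ x) ≡ x
    vert-σ   : ∀ x → vert (σ x) ≡ vert x
    vert-orb : ∀ x y → vert x ≡ vert y → SameOrbit σ x y
    face-φ   : ∀ x → face (σ (α x)) ≡ face x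
    face-orb : ∀ x y → face x ≡ face y → SameOrbit (λ z → σ (α z)) x y
    face-sur : ∀ i → ∃ λ x → face x ≡ i
    no-loop  : ∀ x → vert (α x) ≢ vert x
    no-multi : ∀ x y → vert x ≡ vert y → vert (α x) ≡ vert (α y) → x ≡ y
    connected : ∀ u v →
      Path (λ a b → ∃ λ x → vert x ≡ a × vert (α x) ≡ b) (λ _ → ⊤) u v
    -- Euler's formula (genus 0, i.e. a plane embedding): n − d/2 + f = 2
    euler    : 2 * n + 2 * f ≡ d + 4
    inner-tri : ∀ x → face x ≢ outer →
      iter (λ z → σ (α z)) 3 x ≡ x × σ (α x) ≢ x
    outer-len : ∀ x → face x ≡ outer →
      σ (α x) ≢ x × σ (α (σ (α x))) ≢ x
    outer-simple : ∀ x y → face x ≡ outer → face y ≡ outer →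
      vert x ≡ vert y → x ≡ y

module _ {n : ℕ} (G : TriangulatedDisk n) where
  open TriangulatedDisk G

  Adj : Fin n → Fin n → Set
  Adj u v = ∃ λ x → vert x ≡ u × vert (α x) ≡ v

  record IsSeparation (A B : Subset n) : Set where
    field
      cover   : ∀ v → v ∈ A ⊎ v ∈ B
      no-edge : ∀ u v → u ∈ A → u ∉ B → v ∈ B → v ∉ A → ¬ Adj u v

  order : Subset n → Subset n → ℕ
  order A B = ∣ A ∩ B ∣

  Nontrivial : Subset n → Subset n → Set
  Nontrivial A B = (∃ λ v → v ∈ A × v ∉ B) × (∃ λ v → v ∈ B × v ∉ A)

  record IsComponentOfMinus (S X : Subset n) : Set where
    field
      nonempty : ∃ λ v → v ∈ X
      disjoint : ∀ v → v ∈ X → v ∉ S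
      conn     : ∀ u v → u ∈ X → v ∈ X → Path Adj (λ w → w ∈ X) u v
      maximal  : ∀ u v → u ∈ X → v ∉ S → Adj u v → v ∈ X

-- Around a vertex c the rotation σ lists the neighbours of c cyclically, and two
-- consecutive ones are adjacent unless they bound the outer corner at c, of which there
-- is at most one. Let S = A ∩ B, X = A ∖ B, Y = B ∖ A. For c ∈ S, at most one neighbour
-- t of c lies in S, so two neighbours of c outside S are joined through neighbours of c
-- along an arc between them avoiding the outer corner, unless this arc passes t; then ct
-- has inner triangles on both sides, and the arc joins the two neighbours to their
-- apexes. If both apexes were in X, no vertex of Y could be adjacent to c or t,
-- contradicting connectivity. Hence the X-neighbours of any c ∈ S lie in one component
-- of G[X], and so do the X-neighbours of two adjacent vertices of S. Repairing every
-- excursion of a path of G between two vertices of X through S and Y with these facts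
-- shows that G[X] is connected.

module Submission where

open import Data.Empty using (⊥; ⊥-elim)
open import Data.Fin using (Fin) renaming (_≟_ to _≟ᶠ_)
open import Data.Fin.Subset using (Subset; _∈_; _∉_; _∩_; _─_; _-_; ⁅_⁆; ∣_∣; inside; outside)
open import Data.Fin.Subset.Properties
  using (_∈?_; x∈p∩q⁺; x∈p∩q⁻; x∈p∧x∉q⇒x∈p─q; p─q⊆p; x∈p∧x≢y⇒x∈p-y; x∈⁅x⁆; p∩q≢∅⇒∣p─q∣<∣p∣)
open import Data.Nat using (ℕ; zero; suc; _+_; _∸_; _≤_; _<_; z≤n; s≤s; _≤′_; ≤′-refl; ≤′-step)
open import Data.Nat.Induction using (<-rec)
open import Data.Nat.Properties
open import Data.Product using (Σ; ∃; _×_; _,_; proj₁; proj₂; map₂)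
open import Data.Sum using (_⊎_; inj₁; inj₂; [_,_])
import Data.Sum as Sum
open import Data.Unit using (⊤)
open import Data.Vec.Base using (_∷_; here; there)
open import Function using (_∘_)
open import Relation.Binary.Definitions using (tri<; tri≈; tri>)
open import Relation.Binary.PropositionalEquality
  using (_≡_; _≢_; refl; sym; trans; cong; subst; module ≡-Reasoning)
open import Relation.Nullary using (¬_; yes; no)
open import Relation.Unary using (Decidable)

open import Defs

x∈p─q⇒x∉q : ∀ {n} {x : Fin n} {p q : Subset n} → x ∈ p ─ q → x ∉ q
x∈p─q⇒x∉q {p = inside ∷ _} {outside ∷ _} here ()
x∈p─q⇒x∉q {p = _ ∷ _} {_ ∷ _} (there x∈p─q) (there x∈q) = x∈p─q⇒x∉q x∈p─q x∈q

x∈p⇒∣p-x∣<∣p∣ : ∀ {n} {x : Fin n} {p : Subset n} → x ∈ p → ∣ p - x ∣ < ∣ p ∣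
x∈p⇒∣p-x∣<∣p∣ {x = x} {p} x∈p = p∩q≢∅⇒∣p─q∣<∣p∣ p ⁅ x ⁆ (x , x∈p∩q⁺ (x∈p , x∈⁅x⁆ x))

∣p∣≤2⇒atMostTwo : ∀ {n} {p : Subset n} {a b c : Fin n} → ∣ p ∣ ≤ 2 →
  a ∈ p → b ∈ p → c ∈ p → a ≢ c → b ≢ c → a ≡ b
∣p∣≤2⇒atMostTwo {p = p} {a} {b} {c} ∣p∣≤2 a∈p b∈p c∈p a≢c b≢c with a ≟ᶠ b
... | yes a≡b = a≡b
... | no a≢b = ⊥-elim (<⇒≱ (s≤s (s≤s (s≤s z≤n))) (≤-trans 3≤∣p∣ ∣p∣≤2))
  where
  b∈p-a : b ∈ p - a
  b∈p-a = x∈p∧x≢y⇒x∈p-y b∈p (a≢b ∘ sym)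
  c∈p-a-b : c ∈ p - a - b
  c∈p-a-b = x∈p∧x≢y⇒x∈p-y (x∈p∧x≢y⇒x∈p-y c∈p (a≢c ∘ sym)) (b≢c ∘ sym)
  3≤∣p∣ : 3 ≤ ∣ p ∣
  3≤∣p∣ = ≤-trans (s≤s (≤-trans (s≤s (≤-<-trans z≤n (x∈p⇒∣p-x∣<∣p∣ c∈p-a-b)))
                                   (x∈p⇒∣p-x∣<∣p∣ b∈p-a)))
                  (x∈p⇒∣p-x∣<∣p∣ a∈p)

least : ∀ {P : ℕ → Set} → Decidable P → ∃ P → ∃ λ m → P m × (∀ {j} → P j → m ≤ j)
least {P} P? (k , Pk) = <-rec (λ k → P k → ∃ λ m → P m × (∀ {j} → P j → m ≤ j)) search k Pk
  where
  search : ∀ k → (∀ {j} → j < k → P j → ∃ λ m → P m × (∀ {i} → P i → m ≤ i)) →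
           P k → ∃ λ m → P m × (∀ {j} → P j → m ≤ j)
  search k below Pk with anyUpTo? P? k
  ... | yes (j , j<k , Pj) = below j<k Pj
  ... | no none = k , Pk , λ {j} Pj → ≮⇒≥ λ j<k → none (j , j<k , Pj)

iter-+ : ∀ {A : Set} (f : A → A) i j x → iter f (i + j) x ≡ iter f i (iter f j x)
iter-+ f zero j x = refl
iter-+ f (suc i) j x = cong f (iter-+ f i j x)

iter-fixed : ∀ {A : Set} {f : A → A} {x} → f x ≡ x → ∀ k → iter f k x ≡ x
iter-fixed fx≡x zero = refl
iter-fixed {f = f} fx≡x (suc k) = trans (cong f (iter-fixed fx≡x k)) fx≡x

module _ {V : Set} {E : V → V → Set} {P : V → Set} where

  source : ∀ {u v} → Path E P u v → P u
  source (here Pu) = Pu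
  source (step Pu _ _) = Pu

  target : ∀ {u v} → Path E P u v → P v
  target (here Pv) = Pv
  target (step _ _ p) = target p

  snoc : ∀ {u v w} → Path E P u v → E v w → P w → Path E P u w
  snoc (here Pu) e Pw = step Pu e (here Pw)
  snoc (step Pu e p) e′ Pw = step Pu e (snoc p e′ Pw)

  _++ₚ_ : ∀ {u v w} → Path E P u v → Path E P v w → Path E P u w
  here _ ++ₚ q = q
  step Pu e p ++ₚ q = step Pu e (p ++ₚ q)

  reverse : (∀ {a b} → E a b → E b a) → ∀ {u v} → Path E P u v → Path E P v u
  reverse sym-E (here Pu) = here Pu
  reverse sym-E (step Pu e p) = snoc (reverse sym-E p) (sym-E e) Pu

  exit : ∀ {Q : V → Set} → Decidable Q → ∀ {u v} → Path E P u v → Q u → ¬ Q v →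
         ∃ λ z → ∃ λ z′ → Q z × ¬ Q z′ × E z z′
  exit Q? (here _) Qu ¬Qv = ⊥-elim (¬Qv Qu)
  exit Q? {u} (step {v = w} _ e p) Qu ¬Qv with Q? w
  ... | yes Qw = exit Q? p Qw ¬Qv
  ... | no ¬Qw = u , w , Qu , ¬Qw , e

module Rotation {n : ℕ} (G : TriangulatedDisk n) where
  open TriangulatedDisk G

  end : Fin d → Fin n
  end x = vert (α x)

  Adj-sym : ∀ {u v} → Adj G u v → Adj G v u
  Adj-sym (x , refl , refl) = α x , refl , cong vert (α-invol x)

  Adj-irrefl : ∀ {u v} → Adj G u v → u ≢ v
  Adj-irrefl (x , refl , refl) u≡v = no-loop x (sym u≡v)

  vert-iter : ∀ i x → vert (iter σ i x) ≡ vert x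
  vert-iter zero x = refl
  vert-iter (suc i) x = trans (vert-σ _) (vert-iter i x)

  face-σ≡face-α : ∀ x → face (σ x) ≡ face (α x)
  face-σ≡face-α x = trans (cong (face ∘ σ) (sym (α-invol x))) (face-φ (α x))

  -- The inner face through σ x is the triangle (vert x , end (σ x) , end x).
  triangle : ∀ x → face (σ x) ≢ outer → σ (α (σ (α (σ x)))) ≡ α x
  triangle x inner = trans (cong (λ z → σ (α (σ (α (σ z))))) (sym (α-invol x)))
    (proj₁ (inner-tri (α x) (inner ∘ trans (face-σ≡face-α x))))

  vert-σ⁻¹ : ∀ x → vert (σ⁻¹ x) ≡ vert x
  vert-σ⁻¹ x = trans (sym (vert-σ (σ⁻¹ x))) (cong vert (σ-inv₁ x))

  apex-σ : ∀ x → face (σ x) ≢ outer → end (σ (α (σ x))) ≡ end x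
  apex-σ x inner = trans (sym (vert-σ _)) (cong vert (triangle x inner))

  apex-σ⁻¹ : ∀ x → face (σ x) ≢ outer → end (σ⁻¹ (α x)) ≡ end (σ x)
  apex-σ⁻¹ x inner = begin
    end (σ⁻¹ (α x))                      ≡⟨ cong (end ∘ σ⁻¹) (triangle x inner) ⟨
    end (σ⁻¹ (σ (α (σ (α (σ x))))))      ≡⟨ cong end (σ-inv₂ _) ⟩
    vert (α (α (σ (α (σ x)))))           ≡⟨ cong vert (α-invol _) ⟩
    vert (σ (α (σ x)))                   ≡⟨ vert-σ _ ⟩
    end (σ x)                            ∎
    where open ≡-Reasoning

  corner-Adj : ∀ x → face (σ x) ≢ outer → Adj G (end (σ x)) (end x)
  corner-Adj x inner = σ (α (σ x)) , vert-σ _ , apex-σ x inner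

  corner-Adj′ : ∀ x → face x ≢ outer → Adj G (end (σ⁻¹ x)) (end x)
  corner-Adj′ x inner = Adj-sym (subst (λ z → Adj G (end z) (end (σ⁻¹ x))) (σ-inv₁ x)
    (corner-Adj (σ⁻¹ x) (inner ∘ subst (λ z → face z ≡ outer) (σ-inv₁ x))))

  σ-fixed⇒sole-dart : ∀ {x y} → σ x ≡ x → vert y ≡ vert x → y ≡ x
  σ-fixed⇒sole-dart {x} {y} σx≡x vy≡vx with vert-orb x y (sym vy≡vx)
  ... | k , xk≡y = trans (sym xk≡y) (iter-fixed σx≡x k)

  spoke : Fin d → ℕ → Fin n
  spoke x i = end (iter σ i x)

  spoke-Adj : ∀ x i → face (iter σ (suc i) x) ≢ outer → Adj G (spoke x i) (spoke x (suc i))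
  spoke-Adj x i inner = Adj-sym (corner-Adj (iter σ i x) inner)

  record Arc (x y : Fin d) : Set where
    field
      length   : ℕ
      reaches  : iter σ length x ≡ y
      shortest : ∀ {j} → iter σ j x ≡ y → length ≤ j

  arc : ∀ {x y} → vert x ≡ vert y → Arc x y
  arc {x} {y} same with least (λ j → iter σ j x ≟ᶠ y) (vert-orb x y same)
  ... | k , reaches , shortest = record { length = k ; reaches = reaches ; shortest = shortest }

  module _ {x y : Fin d} (W : Arc x y) where
    open Arc W

    rest-reaches : ∀ {i} → i ≤ length → iter σ (length ∸ i) (iter σ i x) ≡ y
    rest-reaches {i} i≤k = begin
      iter σ (length ∸ i) (iter σ i x)  ≡⟨ iter-+ σ (length ∸ i) i x ⟨
      iter σ (length ∸ i + i) x         ≡⟨ cong (λ m → iter σ m x) (m∸n+n≡m i≤k) ⟩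
      iter σ length x                   ≡⟨ reaches ⟩
      y                                 ∎
      where open ≡-Reasoning

    shorter-arc-absurd : ∀ {z a b} → iter σ a z ≡ x → iter σ b z ≡ y → a ≤ b → b < length → ⊥
    shorter-arc-absurd {z} {a} {b} za≡x zb≡y a≤b b<k =
      <⇒≱ (≤-<-trans (m∸n≤m b a) b<k) (shortest (begin
        iter σ (b ∸ a) x                 ≡⟨ cong (iter σ (b ∸ a)) za≡x ⟨
        iter σ (b ∸ a) (iter σ a z)      ≡⟨ iter-+ σ (b ∸ a) a z ⟨
        iter σ (b ∸ a + a) z             ≡⟨ cong (λ m → iter σ m z) (m∸n+n≡m a≤b) ⟩
        iter σ b z                       ≡⟨ zb≡y ⟩
        y                                ∎))
      where open ≡-Reasoning

    revisit-absurd : ∀ {i j} → i < j → j ≤ length → iter σ i x ≡ iter σ j x → ⊥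
    revisit-absurd {i} {j} i<j j≤k eq =
      <⇒≱ (<-≤-trans (+-monoʳ-< (length ∸ j) i<j) (≤-reflexive (m∸n+n≡m j≤k))) (shortest (begin
        iter σ (length ∸ j + i) x         ≡⟨ iter-+ σ (length ∸ j) i x ⟩
        iter σ (length ∸ j) (iter σ i x)  ≡⟨ cong (iter σ (length ∸ j)) eq ⟩
        iter σ (length ∸ j) (iter σ j x)  ≡⟨ rest-reaches j≤k ⟩
        y                                 ∎))
      where open ≡-Reasoning

    arc-injective : ∀ {i j} → i ≤ length → j ≤ length → iter σ i x ≡ iter σ j x → i ≡ j
    arc-injective {i} {j} i≤k j≤k eq with <-cmp i j
    ... | tri< i<j _ _ = ⊥-elim (revisit-absurd i<j j≤k eq)
    ... | tri≈ _ i≡j _ = i≡j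
    ... | tri> _ _ j<i = ⊥-elim (revisit-absurd j<i i≤k (sym eq))

  arcs-disjoint : ∀ {x y} (W : Arc x y) (W′ : Arc y x) {i j} →
    1 ≤ i → i ≤ Arc.length W → 1 ≤ j → j ≤ Arc.length W′ → iter σ i x ≢ iter σ j y
  arcs-disjoint {x} {y} W W′ {i} {j} 1≤i i≤k 1≤j j≤k′ eq =
    [ (λ a≤b → shorter-arc-absurd W′ to-y to-x a≤b (∸-monoʳ-< 1≤j j≤k′))
    , (λ b≤a → shorter-arc-absurd W to-x to-y b≤a (∸-monoʳ-< 1≤i i≤k))
    ] (≤-total (Arc.length W ∸ i) (Arc.length W′ ∸ j))
    where
    to-y : iter σ (Arc.length W ∸ i) (iter σ i x) ≡ y
    to-y = rest-reaches W i≤k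
    to-x : iter σ (Arc.length W′ ∸ j) (iter σ i x) ≡ x
    to-x = trans (cong (iter σ (Arc.length W′ ∸ j)) eq) (rest-reaches W′ j≤k′)

record Separator {n : ℕ} (G : TriangulatedDisk n) (S X Y : Fin n → Set) : Set where
  field
    S?           : Decidable S
    classify     : ∀ v → X v ⊎ Y v ⊎ S v
    X⇒∉S         : ∀ {v} → X v → ¬ S v
    Y⇒∉S         : ∀ {v} → Y v → ¬ S v
    X⇒∉Y         : ∀ {v} → X v → ¬ Y v
    no-X-Y-edge  : ∀ {u v} → X u → Y v → ¬ Adj G u v
    S-atMostTwo  : ∀ {a b c} → S a → S b → S c → a ≢ c → b ≢ c → a ≡ b

swap : ∀ {n} {G : TriangulatedDisk n} {S X Y} → Separator G S X Y → Separator G S Y X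
swap {G = G} sep = record
  { S?          = S?
  ; classify    = λ v → [ inj₂ ∘ inj₁ , [ inj₁ , inj₂ ∘ inj₂ ] ] (classify v)
  ; X⇒∉S        = Y⇒∉S
  ; Y⇒∉S        = X⇒∉S
  ; X⇒∉Y        = λ Yv Xv → X⇒∉Y Xv Yv
  ; no-X-Y-edge = λ Yu Xv uv → no-X-Y-edge Xv Yu (Rotation.Adj-sym G uv)
  ; S-atMostTwo = S-atMostTwo
  }
  where open Separator sep

module Sides {n : ℕ} {G : TriangulatedDisk n} {S X Y : Fin n → Set} (sep : Separator G S X Y) where
  open TriangulatedDisk G
  open Rotation G
  open Separator sep

  X-closed : ∀ {u v} → X u → ¬ S v → Adj G u v → X v
  X-closed {v = v} Xu ¬Sv uv with classify v
  ... | inj₁ Xv = Xv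
  ... | inj₂ (inj₁ Yv) = ⊥-elim (no-X-Y-edge Xu Yv uv)
  ... | inj₂ (inj₂ Sv) = ⊥-elim (¬Sv Sv)

  Y-closed : ∀ {u v} → Y u → ¬ S v → Adj G u v → Y v
  Y-closed {v = v} Yu ¬Sv uv with classify v
  ... | inj₁ Xv = ⊥-elim (no-X-Y-edge Xv Yu (Adj-sym uv))
  ... | inj₂ (inj₁ Yv) = Yv
  ... | inj₂ (inj₂ Sv) = ⊥-elim (¬Sv Sv)

  Y? : Decidable Y
  Y? v with classify v
  ... | inj₁ Xv = no (X⇒∉Y Xv)
  ... | inj₂ (inj₁ Yv) = yes Yv
  ... | inj₂ (inj₂ Sv) = no λ Yv → Y⇒∉S Yv Sv

  Linked : Fin n → Fin n → Set
  Linked u v = Path (Adj G) X u v ⊎ Path (Adj G) Y u v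

  Linked-sym : ∀ {u v} → Linked u v → Linked v u
  Linked-sym = Sum.map (reverse Adj-sym) (reverse Adj-sym)

  Linked-X : ∀ {u v} → X u → Linked u v → Path (Adj G) X u v
  Linked-X Xu (inj₁ p) = p
  Linked-X Xu (inj₂ p) = ⊥-elim (X⇒∉Y Xu (source p))

  X-Y-unlinked : ∀ {u v} → X u → Y v → ¬ Linked u v
  X-Y-unlinked Xu Yv u~v = X⇒∉Y (target (Linked-X Xu u~v)) Yv

  path-along : (Z : Fin n → Set) → (∀ {u v} → Z u → ¬ S v → Adj G u v → Z v) →
    (v : ℕ → Fin n) → ∀ {p q} → p ≤′ q →
    (∀ {i} → p < i → i ≤ q → ¬ S (v i)) →
    (∀ {i} → p ≤ i → i < q → Adj G (v i) (v (suc i))) →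
    Z (v p) → Path (Adj G) Z (v p) (v q)
  path-along Z closed v ≤′-refl _ _ Zp = here Zp
  path-along Z closed v {p} {suc q} (≤′-step p≤q) ¬S adj Zp =
    snoc prefix last (closed (target prefix) (¬S (s≤s (≤′⇒≤ p≤q)) ≤-refl) last)
    where
    prefix : Path (Adj G) Z (v p) (v q)
    prefix = path-along Z closed v p≤q (λ p<i i≤q → ¬S p<i (m≤n⇒m≤1+n i≤q))
                                       (λ p≤i i<q → adj p≤i (m≤n⇒m≤1+n i<q)) Zp
    last : Adj G (v q) (v (suc q))
    last = adj (≤′⇒≤ p≤q) ≤-refl

  linked-along : (v : ℕ → Fin n) → ∀ {p q} → p ≤ q →
    (∀ {i} → p ≤ i → i ≤ q → ¬ S (v i)) →
    (∀ {i} → p ≤ i → i < q → Adj G (v i) (v (suc i))) →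
    Linked (v p) (v q)
  linked-along v {p} p≤q ¬S adj with classify (v p)
  ... | inj₁ Xp = inj₁ (path-along X X-closed v (≤⇒≤′ p≤q) (¬S ∘ <⇒≤) adj Xp)
  ... | inj₂ (inj₁ Yp) = inj₂ (path-along Y Y-closed v (≤⇒≤′ p≤q) (¬S ∘ <⇒≤) adj Yp)
  ... | inj₂ (inj₂ Sp) = ⊥-elim (¬S ≤-refl p≤q Sp)

  S-dart-unique : ∀ {c x y} → S c → vert x ≡ c → vert y ≡ c → S (end x) → S (end y) → x ≡ y
  S-dart-unique {x = x} {y} Sc refl vy Sx Sy = no-multi x y (sym vy)
    (S-atMostTwo Sx Sy Sc (no-loop x) (λ e → no-loop y (trans e (sym vy))))

  -- An edge from c to the other vertex of S with inner triangles on both sides;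
  -- left and right are the apexes of these triangles.
  record InnerSEdge (c : Fin n) : Set where
    field
      dart         : Fin d
      vert-dart    : vert dart ≡ c
      end∈S        : S (end dart)
      face-inner   : face dart ≢ outer
      σ-face-inner : face (σ dart) ≢ outer

    left right : Fin n
    left = end (σ⁻¹ dart)
    right = end (σ dart)

    c-Adj-left : Adj G c left
    c-Adj-left = σ⁻¹ dart , trans (vert-σ⁻¹ dart) vert-dart , refl

    left-Adj-end : Adj G left (end dart)
    left-Adj-end = corner-Adj′ dart face-inner

    right-Adj-end : Adj G right (end dart)
    right-Adj-end = corner-Adj dart σ-face-inner

  open InnerSEdge

  InnerSEdge-unique : ∀ {c} → S c → (e e′ : InnerSEdge c) → dart e ≡ dart e′
  InnerSEdge-unique Sc e e′ = S-dart-unique Sc (vert-dart e) (vert-dart e′) (end∈S e) (end∈S e′)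

  reverse-edge : ∀ {c} → S c → (e : InnerSEdge c) →
    Σ (InnerSEdge (end (dart e))) λ e′ → left e′ ≡ right e × right e′ ≡ left e
  reverse-edge Sc e = e′ , apex-σ⁻¹ τ (σ-face-inner e) , right-e′
    where
    τ : Fin d
    τ = dart e
    right-e′ : end (σ (α τ)) ≡ left e
    right-e′ = subst (λ z → end (σ (α z)) ≡ left e) (σ-inv₁ τ)
      (apex-σ (σ⁻¹ τ) (subst (λ z → face z ≢ outer) (sym (σ-inv₁ τ)) (face-inner e)))
    e′ : InnerSEdge (end τ)
    e′ = record
      { dart         = α τ
      ; vert-dart    = refl
      ; end∈S        = subst S (sym (trans (cong vert (α-invol τ)) (vert-dart e))) Sc
      ; face-inner   = σ-face-inner e ∘ trans (face-σ≡face-α τ)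
      ; σ-face-inner = face-inner e ∘ trans (sym (face-φ τ))
      }

  module ArcAround {c : Fin n} {x y : Fin d} (Sc : S c) (vert-x : vert x ≡ c) (W : Arc x y)
    (inner : ∀ {j} → 1 ≤ j → j ≤ Arc.length W → face (iter σ j x) ≢ outer) where
    open Arc W

    adj : ∀ {p i} → p ≤ i → i < length → Adj G (spoke x i) (spoke x (suc i))
    adj {i = i} _ i<k = spoke-Adj x i (inner (s≤s z≤n) i<k)

    S-spoke-unique : ∀ {i j} → i ≤ length → j ≤ length → S (spoke x i) → S (spoke x j) → i ≡ j
    S-spoke-unique {i} {j} i≤k j≤k Si Sj = arc-injective W i≤k j≤k
      (S-dart-unique Sc (trans (vert-iter i x) vert-x) (trans (vert-iter j x) vert-x) Si Sj)

    edge-at : ∀ {i} → suc i < length → S (spoke x (suc i)) → InnerSEdge c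
    edge-at {i} i+1<k S₊ = record
      { dart         = iter σ (suc i) x
      ; vert-dart    = trans (vert-iter (suc i) x) vert-x
      ; end∈S        = S₊
      ; face-inner   = inner (s≤s z≤n) (<⇒≤ i+1<k)
      ; σ-face-inner = inner (s≤s z≤n) i+1<k
      }

    arc-linked : ¬ S (end x) → ¬ S (end y) →
      Linked (end x) (end y) ⊎
      Σ (InnerSEdge c) λ e → Linked (end x) (left e) × Linked (right e) (end y)
    arc-linked ¬S₀ ¬Sₖ with anyUpTo? (S? ∘ spoke x) length
    ... | no none = inj₁ (subst (Linked (end x) ∘ end) reaches (linked-along (spoke x) z≤n ¬S adj))
      where
      ¬S : ∀ {i} → 0 ≤ i → i ≤ length → ¬ S (spoke x i)
      ¬S {i} _ i≤k with m≤n⇒m<n∨m≡n i≤k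
      ... | inj₁ i<k = λ Si → none (i , i<k , Si)
      ... | inj₂ refl = ¬Sₖ ∘ subst (S ∘ end) reaches
    ... | yes (zero , _ , S₀) = ⊥-elim (¬S₀ S₀)
    ... | yes (suc i , i+1<k , S₊) = inj₂ (edge-at i+1<k S₊ , before , after)
      where
      unique : ∀ {j} → j ≤ length → S (spoke x j) → j ≡ suc i
      unique j≤k Sj = S-spoke-unique j≤k (<⇒≤ i+1<k) Sj S₊
      i≤k : i ≤ length
      i≤k = ≤-trans (n≤1+n i) (<⇒≤ i+1<k)
      before : Linked (end x) (left (edge-at i+1<k S₊))
      before = subst (Linked (end x) ∘ end) (sym (σ-inv₂ _))
        (linked-along (spoke x) z≤n
          (λ {j} _ j≤i Sj → 1+n≰n (≤-trans (≤-reflexive (sym (unique (≤-trans j≤i i≤k) Sj))) j≤i))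
          (λ _ j<i → adj z≤n (<-≤-trans j<i i≤k)))
      after : Linked (right (edge-at i+1<k S₊)) (end y)
      after = subst (Linked (right (edge-at i+1<k S₊)) ∘ end) reaches
        (linked-along (spoke x) i+1<k
          (λ {j} i+2≤j j≤k Sj → 1+n≰n (≤-trans i+2≤j (≤-reflexive (unique j≤k Sj))))
          (λ i+2≤j j<k → adj i+2≤j j<k))

  neighbours-linked : ∀ {c a b} → S c → Adj G c a → Adj G c b → ¬ S a → ¬ S b →
    Linked a b ⊎ Σ (InnerSEdge c) λ e →
      (Linked a (left e) × Linked (right e) b) ⊎ (Linked b (left e) × Linked (right e) a)
  neighbours-linked {c} Sc (x , vx , refl) (y , vy , refl) =
    via-arcs (arc (trans vx (sym vy))) (arc (trans vy (sym vx)))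
    where
    via-arcs : Arc x y → Arc y x → ¬ S (end x) → ¬ S (end y) →
      Linked (end x) (end y) ⊎ Σ (InnerSEdge c) λ e →
        (Linked (end x) (left e) × Linked (right e) (end y)) ⊎
        (Linked (end y) (left e) × Linked (right e) (end x))
    via-arcs W W′ ¬Sa ¬Sb with anyUpTo? (λ i → face (iter σ (suc i) x) ≟ᶠ outer) (Arc.length W)
    ... | no none = Sum.map₂ (map₂ inj₁) (ArcAround.arc-linked Sc vx W inner ¬Sa ¬Sb)
      where
      inner : ∀ {j} → 1 ≤ j → j ≤ Arc.length W → face (iter σ j x) ≢ outer
      inner {suc j} _ j<k outerⱼ = none (j , j<k , outerⱼ)
    ... | yes (i , i<k , outerᵢ) =
      Sum.map Linked-sym (map₂ inj₂) (ArcAround.arc-linked Sc vy W′ inner′ ¬Sb ¬Sa)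
      where
      -- c has only one outer corner, and it lies on the arc W.
      inner′ : ∀ {j} → 1 ≤ j → j ≤ Arc.length W′ → face (iter σ j y) ≢ outer
      inner′ {j} 1≤j j≤k′ outerⱼ = arcs-disjoint W W′ (s≤s z≤n) i<k 1≤j j≤k′
        (outer-simple _ _ outerᵢ outerⱼ
          (trans (vert-iter (suc i) x) (trans vx (sym (trans (vert-iter j y) vy)))))

  X-apexes⇒no-Y-neighbour : ∀ {c y} → S c → (e : InnerSEdge c) → X (left e) → X (right e) →
    Adj G c y → ¬ Y y
  X-apexes⇒no-Y-neighbour Sc e Xl Xr cy Yy
    with neighbours-linked Sc (c-Adj-left e) cy (X⇒∉S Xl) (Y⇒∉S Yy)
  ... | inj₁ l~y = X-Y-unlinked Xl Yy l~y
  ... | inj₂ (e′ , inj₁ (_ , r′~y)) =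
    X-Y-unlinked (subst X (cong (end ∘ σ) (InnerSEdge-unique Sc e e′)) Xr) Yy r′~y
  ... | inj₂ (e′ , inj₂ (y~l′ , _)) =
    X-Y-unlinked (subst X (cong (end ∘ σ⁻¹) (InnerSEdge-unique Sc e e′)) Xl) Yy (Linked-sym y~l′)

  S-meets-Y : ∀ {x} → X x → ∃ Y → ∃ λ c → ∃ λ y → S c × Y y × Adj G c y
  S-meets-Y Xx (y , Yy) with exit Y? (connected y _) Yy (X⇒∉Y Xx)
  ... | z , z′ , Yz , ¬Yz′ , zz′ with classify z′
  ... | inj₁ Xz′ = ⊥-elim (no-X-Y-edge Xz′ Yz (Adj-sym zz′))
  ... | inj₂ (inj₁ Yz′) = ⊥-elim (¬Yz′ Yz′)
  ... | inj₂ (inj₂ Sz′) = z′ , z , Sz′ , Yz , Adj-sym zz′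

  -- Since G is connected, Y is adjacent to c or to the other end of e, and e has
  -- X-apexes seen from either end.
  X-apexes-absurd : ∃ Y → ∀ {c} → S c → (e : InnerSEdge c) → X (left e) → X (right e) → ⊥
  X-apexes-absurd y₀ {c} Sc e Xl Xr with S-meets-Y Xl y₀
  ... | c′ , y , Sc′ , Yy , c′y with c′ ≟ᶠ c
  ... | yes refl = X-apexes⇒no-Y-neighbour Sc e Xl Xr c′y Yy
  ... | no c′≢c with reverse-edge Sc e
  ... | e′ , l′≡r , r′≡l
    with S-atMostTwo Sc′ (end∈S e) Sc c′≢c (Adj-irrefl (dart e , vert-dart e , refl) ∘ sym)
  ... | refl =
    X-apexes⇒no-Y-neighbour (end∈S e) e′ (subst X (sym l′≡r) Xr) (subst X (sym r′≡l) Xl) c′y Yy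

  X-neighbours-linked : ∃ Y → ∀ {c a b} → S c → Adj G c a → Adj G c b → X a → X b →
    Path (Adj G) X a b
  X-neighbours-linked y₀ Sc ca cb Xa Xb with neighbours-linked Sc ca cb (X⇒∉S Xa) (X⇒∉S Xb)
  ... | inj₁ a~b = Linked-X Xa a~b
  ... | inj₂ (e , inj₁ (a~l , r~b)) =
    ⊥-elim (X-apexes-absurd y₀ Sc e (target (Linked-X Xa a~l))
                                     (target (Linked-X Xb (Linked-sym r~b))))
  ... | inj₂ (e , inj₂ (b~l , r~a)) =
    ⊥-elim (X-apexes-absurd y₀ Sc e (target (Linked-X Xb b~l))
                                     (target (Linked-X Xa (Linked-sym r~a))))

  X-and-Y-neighbours⇒S-neighbour : ∀ {c a y} → S c → Adj G c a → X a → Adj G c y → Y y →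
    ∃ λ t → S t × Adj G c t
  X-and-Y-neighbours⇒S-neighbour Sc ca Xa cy Yy with neighbours-linked Sc ca cy (X⇒∉S Xa) (Y⇒∉S Yy)
  ... | inj₁ a~y = ⊥-elim (X-Y-unlinked Xa Yy a~y)
  ... | inj₂ (e , _) = end (dart e) , end∈S e , (dart e , vert-dart e , refl)

  X-neighbour⇒σ-moves : ∀ {c a τ} → Adj G c a → X a → vert τ ≡ c → S (end τ) → σ τ ≢ τ
  X-neighbour⇒σ-moves (x , vx , refl) Xa vτ Sτ σ-fixed =
    X⇒∉S Xa (subst (S ∘ end) (sym (σ-fixed⇒sole-dart σ-fixed (trans vx (sym vτ)))) Sτ)

  common-neighbour : ∀ {c a τ} → S c → Adj G c a → X a → vert τ ≡ c → S (end τ) →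
    ∃ λ b → ¬ S b × Adj G c b × Adj G b (end τ)
  common-neighbour {c} {τ = τ} Sc ca Xa vτ Sτ with face τ ≟ᶠ outer
  ... | yes outerτ =
    end (σ τ) ,
    (λ Sστ → σ-moves (S-dart-unique Sc (trans (vert-σ τ) vτ) vτ Sστ Sτ)) ,
    (σ τ , trans (vert-σ τ) vτ , refl) ,
    corner-Adj τ (λ outerστ → σ-moves (outer-simple _ _ outerστ outerτ (vert-σ τ)))
    where
    σ-moves : σ τ ≢ τ
    σ-moves = X-neighbour⇒σ-moves ca Xa vτ Sτ
  ... | no innerτ =
    end (σ⁻¹ τ) ,
    (λ Sσ⁻¹τ → σ-moves
      (trans (cong σ (sym (S-dart-unique Sc (trans (vert-σ⁻¹ τ) vτ) vτ Sσ⁻¹τ Sτ))) (σ-inv₁ τ))) ,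
    (σ⁻¹ τ , trans (vert-σ⁻¹ τ) vτ , refl) ,
    corner-Adj′ τ innerτ
    where
    σ-moves : σ τ ≢ τ
    σ-moves = X-neighbour⇒σ-moves ca Xa vτ Sτ

  X-route : ∀ {a w t} → X a → Linked a w → Adj G w t →
    ∃ λ w → X w × Path (Adj G) X a w × Adj G w t
  X-route Xa a~w wt = _ , target (Linked-X Xa a~w) , Linked-X Xa a~w , wt

  X-route-to-S-neighbour : ∀ {c a t} → S c → Adj G c a → X a → Adj G c t → S t →
    ∃ λ w → X w × Path (Adj G) X a w × Adj G w t
  X-route-to-S-neighbour Sc ca Xa (τ , vτ , refl) Sτ with common-neighbour Sc ca Xa vτ Sτ
  ... | b , ¬Sb , cb , bt with neighbours-linked Sc ca cb (X⇒∉S Xa) ¬Sb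
  ... | inj₁ a~b = X-route Xa a~b bt
  ... | inj₂ (e , inj₁ (a~l , _)) =
    X-route Xa a~l
      (subst (Adj G (left e) ∘ end) (S-dart-unique Sc (vert-dart e) vτ (end∈S e) Sτ) (left-Adj-end e))
  ... | inj₂ (e , inj₂ (_ , r~a)) =
    X-route Xa (Linked-sym r~a)
      (subst (Adj G (right e) ∘ end) (S-dart-unique Sc (vert-dart e) vτ (end∈S e) Sτ) (right-Adj-end e))

  module _ (y₀ : ∃ Y) {w : Fin n} (Xw : X w) where

    Good : Fin n → Set
    Good c = ∀ {a} → X a → Adj G c a → Path (Adj G) X w a

    Good-spreads : ∀ {c c′} → S c → S c′ → Adj G c′ c → Good c → Good c′
    Good-spreads Sc Sc′ c′c good Xa c′a with X-route-to-S-neighbour Sc′ c′a Xa c′c Sc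
    ... | w′ , Xw′ , a⇝w′ , w′c = good Xw′ (Adj-sym w′c) ++ₚ reverse Adj-sym a⇝w′

    data Reached : Fin n → Set where
      X-reached : ∀ {z} → Path (Adj G) X w z → Reached z
      S-reached : ∀ {z} → S z → Good z → Reached z
      Y-reached : ∀ {z c} → Y z → S c → Good c → Reached z

    step-Reached : ∀ {z z′} → Reached z → Adj G z z′ → Reached z′
    step-Reached {z′ = z′} r zz′ with classify z′
    step-Reached (X-reached p) zz′ | inj₁ Xz′ = X-reached (snoc p zz′ Xz′)
    step-Reached (X-reached p) zz′ | inj₂ (inj₁ Yz′) = ⊥-elim (no-X-Y-edge (target p) Yz′ zz′)
    step-Reached (X-reached p) zz′ | inj₂ (inj₂ Sz′) =
      S-reached Sz′ λ Xa z′a → p ++ₚ X-neighbours-linked y₀ Sz′ (Adj-sym zz′) z′a (target p) Xa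
    step-Reached (S-reached Sz good) zz′ | inj₁ Xz′ = X-reached (good Xz′ zz′)
    step-Reached (S-reached Sz good) zz′ | inj₂ (inj₁ Yz′) = Y-reached Yz′ Sz good
    step-Reached (S-reached Sz good) zz′ | inj₂ (inj₂ Sz′) =
      S-reached Sz′ (Good-spreads Sz Sz′ (Adj-sym zz′) good)
    step-Reached (Y-reached Yz Sc good) zz′ | inj₁ Xz′ = ⊥-elim (no-X-Y-edge Xz′ Yz (Adj-sym zz′))
    step-Reached (Y-reached Yz Sc good) zz′ | inj₂ (inj₁ Yz′) = Y-reached Yz′ Sc good
    step-Reached {z′ = z′} (Y-reached {c = c} Yz Sc good) zz′ | inj₂ (inj₂ Sz′) with c ≟ᶠ z′
    ... | yes refl = S-reached Sz′ good
    ... | no c≢z′ = S-reached Sz′ good′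
      where
      -- An S-neighbour t of z′ differs from z′, and so does c; hence t = c.
      good′ : Good z′
      good′ Xa z′a with X-and-Y-neighbours⇒S-neighbour Sz′ z′a Xa (Adj-sym zz′) Yz
      ... | t , St , z′t with S-atMostTwo St Sc Sz′ (Adj-irrefl z′t ∘ sym) c≢z′
      ... | refl = Good-spreads Sc Sz′ z′t good Xa z′a

    walk-Reached : ∀ {z v} → Reached z → Path (Adj G) (λ _ → ⊤) z v → Reached v
    walk-Reached r (here _) = r
    walk-Reached r (step _ e p) = walk-Reached (step-Reached r e) p

    reached : ∀ {v} → X v → Path (Adj G) X w v
    reached {v} Xv with walk-Reached (X-reached (here Xw)) (connected w v)
    ... | X-reached p = p
    ... | S-reached Sv _ = ⊥-elim (X⇒∉S Xv Sv)
    ... | Y-reached Yv _ _ = ⊥-elim (X⇒∉Y Xv Yv)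

  X-connected : ∃ Y → ∀ {u v} → X u → X v → Path (Adj G) X u v
  X-connected y₀ Xu = reached y₀ Xu

module _ {n : ℕ} {G : TriangulatedDisk n} where
  open Sides

  separation⇒Separator : ∀ {A B} → IsSeparation G A B → ∣ A ∩ B ∣ ≤ 2 →
    Separator G (_∈ A ∩ B) (_∈ A ─ B) (_∈ B ─ A)
  separation⇒Separator {A} {B} sep ∣A∩B∣≤2 = record
    { S?          = _∈? A ∩ B
    ; classify    = classify
    ; X⇒∉S        = λ v∈A─B v∈A∩B → x∈p─q⇒x∉q v∈A─B (proj₂ (x∈p∩q⁻ A B v∈A∩B))
    ; Y⇒∉S        = λ v∈B─A v∈A∩B → x∈p─q⇒x∉q v∈B─A (proj₁ (x∈p∩q⁻ A B v∈A∩B))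
    ; X⇒∉Y        = λ v∈A─B v∈B─A → x∈p─q⇒x∉q v∈A─B (p─q⊆p B A v∈B─A)
    ; no-X-Y-edge = λ u∈A─B v∈B─A → no-edge _ _ (p─q⊆p A B u∈A─B) (x∈p─q⇒x∉q u∈A─B)
                                                (p─q⊆p B A v∈B─A) (x∈p─q⇒x∉q v∈B─A)
    ; S-atMostTwo = ∣p∣≤2⇒atMostTwo ∣A∩B∣≤2
    }
    where
    open IsSeparation sep
    classify : ∀ v → v ∈ A ─ B ⊎ v ∈ B ─ A ⊎ v ∈ A ∩ B
    classify v with cover v | v ∈? A | v ∈? B
    ... | _ | yes v∈A | yes v∈B = inj₂ (inj₂ (x∈p∩q⁺ (v∈A , v∈B)))
    ... | _ | yes v∈A | no v∉B = inj₁ (x∈p∧x∉q⇒x∈p─q v∈A v∉B)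
    ... | _ | no v∉A | yes v∈B = inj₂ (inj₁ (x∈p∧x∉q⇒x∈p─q v∈B v∉A))
    ... | inj₁ v∈A | no v∉A | _ = ⊥-elim (v∉A v∈A)
    ... | inj₂ v∈B | _ | no v∉B = ⊥-elim (v∉B v∈B)

  component : ∀ {S X : Subset n} {Y} → Separator G (_∈ S) (_∈ X) Y →
    (∃ λ x → x ∈ X) → ∃ Y → IsComponentOfMinus G S X
  component sep x₀ y₀ = record
    { nonempty = x₀
    ; disjoint = λ _ → X⇒∉S
    ; conn     = λ _ _ → X-connected sep y₀
    ; maximal  = λ _ _ → X-closed sep
    }
    where open Separator sep

lemma8 : ∀ {n : ℕ} (G : TriangulatedDisk n) → 4 ≤ n →
    (A B : Subset n) → IsSeparation G A B → Nontrivial G A B →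
    order G A B ≡ 2 →
    IsComponentOfMinus G (A ∩ B) (A ─ B) × IsComponentOfMinus G (A ∩ B) (B ─ A)
lemma8 G _ A B sep ((x , x∈A , x∉B) , (y , y∈B , y∉A)) order≡2 =
  component sides x₀ y₀ , component (swap sides) y₀ x₀
  where
  sides : Separator G (_∈ A ∩ B) (_∈ A ─ B) (_∈ B ─ A)
  sides = separation⇒Separator sep (≤-reflexive order≡2)
  x₀ : ∃ λ v → v ∈ A ─ B
  x₀ = x , x∈p∧x∉q⇒x∈p─q x∈A x∉B
  y₀ : ∃ λ v → v ∈ B ─ A
  y₀ = y , x∈p∧x∉q⇒x∈p─q y∈B y∉A
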